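{- Let $n$ be a positive integer with $n\equiv 7\pmod 8$. Let $R_3$ be the number of ordered triples $(s_1,s_2,s_3)$ of squares of integers with $2n=s_1+s_2+s_3$, and let $T$ be the number of ordered triples $(t_1,t_2,t_3)$ of squares of integers with $n=t_1+2t_2+4t_3$. Then $R_3=6T$.
   Context: "Squares of integers" means elements of $\{0,1,4,9,\dots\}$; triples are counted as triples of these square values. -}

module Defs where

open import Data.Nat using (ℕ; zero; suc; _+_; _*_; _≤_; _<_; _≟_; _%_)
open import Data.Nat.Properties using (_≤?_)
open import Data.Product using (Σ; _×_; _,_; ∃)
open import Data.List using (List; length; filter; upTo; cartesianProduct; any)
open import Data.List.Relation.Unary.Any using (Any)
import Data.List.Relation.Unary.Any as Any
open import Relation.Nullary using (Dec; yes; no)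
open import Relation.Nullary.Decidable using (_×-dec_)
open import Relation.Binary.PropositionalEquality using (_≡_)

-- s is the square of an integer (equivalently of a natural number: k² = |k|²)
IsSquare : ℕ → Set
IsSquare s = ∃ λ k → k * k ≡ s

-- decidability: any witness satisfies k ≤ s, so search k ∈ [0, s]
isSquare? : (s : ℕ) → Dec (Any (λ k → k * k ≡ s) (upTo (suc s)))
isSquare? s = Any.any? (λ k → k * k ≟ s) (upTo (suc s))

triples : ℕ → List (ℕ × ℕ × ℕ)
triples N = cartesianProduct (upTo (suc N)) (cartesianProduct (upTo (suc N)) (upTo (suc N)))

SqTriple : (ℕ → ℕ → ℕ → ℕ) → ℕ → ℕ × ℕ × ℕ → Set
SqTriple f m (a , b , c) =
  (Any (λ k → k * k ≡ a) (upTo (suc a)) × Any (λ k → k * k ≡ b) (upTo (suc b)) × Any (λ k → k * k ≡ c) (upTo (suc c)))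
  × f a b c ≡ m

sqTriple? : (f : ℕ → ℕ → ℕ → ℕ) (m : ℕ) (t : ℕ × ℕ × ℕ) → Dec (SqTriple f m t)
sqTriple? f m (a , b , c) = (isSquare? a ×-dec (isSquare? b ×-dec isSquare? c)) ×-dec (f a b c ≟ m)

-- number of ordered triples (t1,t2,t3) of square values with f t1 t2 t3 = m,
-- where every coordinate is ≤ m (automatic when f has all coefficients ≥ 1)
countSq : (ℕ → ℕ → ℕ → ℕ) → ℕ → ℕ
countSq f m = length (filter (sqTriple? f m) (triples m))

R3 : ℕ → ℕ
R3 m = countSq (λ a b c → a + b + c) m

T : ℕ → ℕ
T n = countSq (λ a b c → a + 2 * b + 4 * c) n

module Submission where

-- Since n is odd, a² + b² + c² ≡ 2 (mod 4), so exactly one root is even, say 2y,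
-- and the other two form an ordered pair of odd numbers.  Ordered odd pairs are
-- exactly the pairs (x + 2z , ∣x − 2z∣) with x odd, in either orientation, and
-- (x + 2z)² + (x − 2z)² = 2(x² + 4z²) turns the equation into x² + 2y² + 4z² = n.
-- So φ(p , o , (x , y , z)), which puts 2y at position p ∈ Fin 3 and this pair in
-- orientation o ∈ Fin 2 at the other positions, maps Fin 3 × Fin 2 × roots onto
-- the roots of a² + b² + c² = 2n.  It is injective since 2y is the only even entry
-- and z ≥ 1 makes the two orientations differ; z = 0 is excluded by n ≡ 7 (mod 8),
-- because x² + 2y² ≡ 1 or 3 (mod 8) for odd x.

open import Defs
open import Data.Nat using (ℕ; zero; suc; _+_; _*_; _%_; _/_; _<_; _≤_; z≤n; s≤s; ∣_-_∣; _≟_)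
open import Data.Nat.Properties
open import Data.Nat.DivMod using (m≡m%n+[m/n]*n; [m+kn]%n≡m%n)
open import Data.Nat.Tactic.RingSolver using (solve-∀)
open import Data.Fin using (Fin; zero; suc)
open import Data.Product using (∃; _×_; _,_; proj₁; proj₂; swap)
open import Data.Sum using (_⊎_; inj₁; inj₂)
open import Data.Empty using (⊥; ⊥-elim)
open import Data.List using (List; []; _∷_; length; map; filter; upTo; cartesianProduct; allFin; _++_)
open import Data.List.Properties using (length-map; length-++; length-tabulate)
open import Data.List.Membership.Propositional using (_∈_)
open import Data.List.Membership.Propositional.Properties
  using (∈-map⁺; ∈-map⁻; ∈-filter⁺; ∈-filter⁻; ∈-cartesianProduct⁺; ∈-cartesianProduct⁻; ∈-upTo⁺; ∈-allFin)
open import Data.List.Membership.Propositional.Properties.WithK using (unique∧set⇒bag)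
open import Data.List.Relation.Binary.BagAndSetEquality using (∼bag⇒↭)
open import Data.List.Relation.Binary.Permutation.Propositional.Properties using (↭-length)
open import Data.List.Relation.Unary.Any using (Any; here; there; satisfied)
import Data.List.Relation.Unary.Any as Any
import Data.List.Relation.Unary.All as All
import Data.List.Relation.Unary.All.Properties as All
open import Data.List.Relation.Unary.AllPairs using ([]; _∷_)
open import Data.List.Relation.Unary.Unique.Propositional using (Unique)
open import Data.List.Relation.Unary.Unique.Propositional.Properties using (upTo⁺; allFin⁺; cartesianProduct⁺; filter⁺)
open import Function.Bundles using (mk⇔)
open import Relation.Binary.Definitions using (tri<; tri≈; tri>)
open import Relation.Binary.PropositionalEquality using (_≡_; refl; sym; trans; cong; cong₂; subst; module ≡-Reasoning)

open ≡-Reasoning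

module _ {A B : Set} (f : B → A) where

  InjectiveOn : List B → Set
  InjectiveOn ys = ∀ {a b} → a ∈ ys → b ∈ ys → f a ≡ f b → a ≡ b

  unique-map : ∀ {ys} → Unique ys → InjectiveOn ys → Unique (map f ys)
  unique-map [] _ = []
  unique-map (a∉ ∷ u) inj =
    All.map⁺ (All.tabulate λ b∈ fa≡fb → All.lookup a∉ b∈ (inj (here refl) (there b∈) fa≡fb))
    ∷ unique-map u (λ a∈ b∈ → inj (there a∈) (there b∈))

  -- If f is injective on ys and maps ys onto xs, both lists being duplicate-free,
  -- then they have the same length (they are permutations of map f ys and ys).
  length-by-image : ∀ {xs ys} → Unique xs → Unique ys → InjectiveOn ys →
                    (∀ {y} → y ∈ ys → f y ∈ xs) →
                    (∀ {x} → x ∈ xs → ∃ λ y → y ∈ ys × x ≡ f y) →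
                    length xs ≡ length ys
  length-by-image {xs} {ys} uxs uys inj into onto =
    trans (↭-length (∼bag⇒↭ (unique∧set⇒bag uxs (unique-map uys inj) (mk⇔ to from))))
          (length-map f ys)
    where
    to : ∀ {x} → x ∈ xs → x ∈ map f ys
    to x∈ with y , y∈ , refl ← onto x∈ = ∈-map⁺ f y∈
    from : ∀ {x} → x ∈ map f ys → x ∈ xs
    from x∈ with y , y∈ , refl ← ∈-map⁻ f x∈ = into y∈

length-cartesianProduct : ∀ {A B : Set} (xs : List A) (ys : List B) →
                          length (cartesianProduct xs ys) ≡ length xs * length ys
length-cartesianProduct [] ys = refl
length-cartesianProduct (x ∷ xs) ys = begin
  length (map (x ,_) ys ++ cartesianProduct xs ys)          ≡⟨ length-++ (map (x ,_) ys) ⟩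
  length (map (x ,_) ys) + length (cartesianProduct xs ys)  ≡⟨ cong₂ _+_ (length-map (x ,_) ys) (length-cartesianProduct xs ys) ⟩
  length ys + length xs * length ys                         ∎

length-allFin : ∀ n → length (allFin n) ≡ n
length-allFin n = length-tabulate (λ i → i)

Triple : Set
Triple = ℕ × ℕ × ℕ

squares : Triple → Triple
squares (a , b , c) = (a * a , b * b , c * c)

value : (ℕ → ℕ → ℕ → ℕ) → Triple → ℕ
value f (a , b , c) = f (a * a) (b * b) (c * c)

IsRoot : (ℕ → ℕ → ℕ → ℕ) → ℕ → Triple → Set
IsRoot f m t = value f t ≡ m

roots : (ℕ → ℕ → ℕ → ℕ) → ℕ → List Triple
roots f m = filter (λ t → value f t ≟ m) (triples m)

-- f bounds each of its arguments, so every root triple of f(a², b², c²) = m lies in triples m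
Dominating : (ℕ → ℕ → ℕ → ℕ) → Set
Dominating f = ∀ a b c → a ≤ f a b c × b ≤ f a b c × c ≤ f a b c

fR fT : ℕ → ℕ → ℕ → ℕ
fR a b c = a + b + c
fT a b c = a + 2 * b + 4 * c

fR-dominating : Dominating fR
fR-dominating a b c =
  ≤-trans (m≤m+n a b) (m≤m+n (a + b) c) ,
  ≤-trans (m≤n+m b a) (m≤m+n (a + b) c) ,
  m≤n+m c (a + b)

fT-dominating : Dominating fT
fT-dominating a b c =
  ≤-trans (m≤m+n a (2 * b)) (m≤m+n (a + 2 * b) (4 * c)) ,
  ≤-trans (m≤n*m b 2) (≤-trans (m≤n+m (2 * b) a) (m≤m+n (a + 2 * b) (4 * c))) ,
  ≤-trans (m≤n*m c 4) (m≤n+m (4 * c) (a + 2 * b))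

square-injective : ∀ {i j} → i * i ≡ j * j → i ≡ j
square-injective {i} {j} eq with <-cmp i j
... | tri< i<j _ _ = ⊥-elim (<-irrefl eq (*-mono-< i<j i<j))
... | tri≈ _ i≡j _ = i≡j
... | tri> _ _ j<i = ⊥-elim (<-irrefl (sym eq) (*-mono-< j<i j<i))

squares-injective : ∀ {s t} → squares s ≡ squares t → s ≡ t
squares-injective eq =
  cong₂ _,_ (square-injective (cong proj₁ eq))
    (cong₂ _,_ (square-injective (cong (λ t → proj₁ (proj₂ t)) eq))
               (square-injective (cong (λ t → proj₂ (proj₂ t)) eq)))

-- a root is at most its square, so roots inherit the bound m
n≤n*n : ∀ n → n ≤ n * n
n≤n*n zero = z≤n
n≤n*n (suc n) = m≤m*n (suc n) (suc n)

unique-triples : ∀ m → Unique (triples m)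
unique-triples m = cartesianProduct⁺ (upTo⁺ (suc m)) (cartesianProduct⁺ (upTo⁺ (suc m)) (upTo⁺ (suc m)))

∈-triples : ∀ {m a b c} → a ≤ m → b ≤ m → c ≤ m → (a , b , c) ∈ triples m
∈-triples a≤m b≤m c≤m =
  ∈-cartesianProduct⁺ (∈-upTo⁺ (s≤s a≤m)) (∈-cartesianProduct⁺ (∈-upTo⁺ (s≤s b≤m)) (∈-upTo⁺ (s≤s c≤m)))

unique-roots : ∀ f m → Unique (roots f m)
unique-roots f m = filter⁺ (λ t → value f t ≟ m) (unique-triples m)

module _ {f : ℕ → ℕ → ℕ → ℕ} {m : ℕ} (dominating : Dominating f) where

  squares-bounded : ∀ i j k → IsRoot f m (i , j , k) → i * i ≤ m × j * j ≤ m × k * k ≤ m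
  squares-bounded i j k refl = dominating (i * i) (j * j) (k * k)

  ∈-roots : ∀ {t} → IsRoot f m t → t ∈ roots f m
  ∈-roots {i , j , k} root with bi , bj , bk ← squares-bounded i j k root =
    ∈-filter⁺ (λ t → value f t ≟ m)
      (∈-triples (≤-trans (n≤n*n i) bi) (≤-trans (n≤n*n j) bj) (≤-trans (n≤n*n k) bk)) root

  -- the square-value triples counted by countSq are exactly the squares of the root triples
  count≡roots : countSq f m ≡ length (roots f m)
  count≡roots =
    length-by-image squares (filter⁺ (sqTriple? f m) (unique-triples m)) (unique-roots f m)
      (λ _ _ → squares-injective) into onto
    where
    square-witness : ∀ i → Any (λ k → k * k ≡ i * i) (upTo (suc (i * i)))
    square-witness i = Any.map (λ i≡k → cong (λ k → k * k) (sym i≡k)) (∈-upTo⁺ (s≤s (n≤n*n i)))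

    into : ∀ {t} → t ∈ roots f m → squares t ∈ filter (sqTriple? f m) (triples m)
    into {i , j , k} t∈ with root ← proj₂ (∈-filter⁻ (λ t → value f t ≟ m) {xs = triples m} t∈)
                            with bi , bj , bk ← squares-bounded i j k root =
      ∈-filter⁺ (sqTriple? f m) (∈-triples bi bj bk) ((square-witness i , square-witness j , square-witness k) , root)

    onto : ∀ {s} → s ∈ filter (sqTriple? f m) (triples m) → ∃ λ t → t ∈ roots f m × s ≡ squares t
    onto {a , b , c} s∈ with _ , (wa , wb , wc) , eq ← ∈-filter⁻ (sqTriple? f m) {xs = triples m} s∈
                        with i , refl ← satisfied wa | j , refl ← satisfied wb | k , refl ← satisfied wc =
      (i , j , k) , ∈-roots eq , refl

Even Odd : ℕ → Set
Even n = ∃ λ k → n ≡ 2 * k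
Odd n = ∃ λ k → n ≡ suc (2 * k)

even∧odd⇒⊥ : ∀ {n} → Even n → Odd n → ⊥
even∧odd⇒⊥ (k , refl) (l , eq) = even≢odd k l eq

odd+even : ∀ {a b} → Odd a → Even b → Odd (a + b)
odd+even (i , refl) (j , refl) = i + j , cong suc (sym (*-distribˡ-+ 2 i j))

data ParityView : ℕ → Set where
  even : ∀ k → ParityView (2 * k)
  odd  : ∀ k → ParityView (suc (2 * k))

parityView : ∀ n → ParityView n
parityView zero = even 0
parityView (suc n) with parityView n
... | even k = odd k
... | odd k = subst ParityView (*-suc 2 k) (even (suc k))

oddBit : ∀ {a} → ParityView a → ℕ
oddBit (even _) = 0
oddBit (odd _) = 1

square-mod4 : ∀ {a} (v : ParityView a) → ∃ λ q → a * a ≡ oddBit v + q * 4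
square-mod4 (even k) = k * k , lemma k
  where lemma : ∀ k → 2 * k * (2 * k) ≡ 0 + k * k * 4
        lemma = solve-∀
square-mod4 (odd k) = k * k + k , lemma k
  where lemma : ∀ k → suc (2 * k) * suc (2 * k) ≡ 1 + (k * k + k) * 4
        lemma = solve-∀

odd-square-mod8 : ∀ i → ∃ λ s → suc (2 * i) * suc (2 * i) ≡ 1 + s * 8
odd-square-mod8 i with parityView i
... | even k = k + 2 * (k * k) , lemma k
  where lemma : ∀ k → suc (2 * (2 * k)) * suc (2 * (2 * k)) ≡ 1 + (k + 2 * (k * k)) * 8
        lemma = solve-∀
... | odd k = 1 + 3 * k + 2 * (k * k) , lemma k
  where lemma : ∀ k → suc (2 * suc (2 * k)) * suc (2 * suc (2 * k)) ≡ 1 + (1 + 3 * k + 2 * (k * k)) * 8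
        lemma = solve-∀

odd-if-7-mod-8 : ∀ {n} → n % 8 ≡ 7 → Odd n
odd-if-7-mod-8 {n} n%8≡7 = 3 + 4 * (n / 8) , (begin
  n                      ≡⟨ m≡m%n+[m/n]*n n 8 ⟩
  n % 8 + n / 8 * 8      ≡⟨ cong (_+ n / 8 * 8) n%8≡7 ⟩
  7 + n / 8 * 8          ≡⟨ lemma (n / 8) ⟩
  suc (2 * (3 + 4 * (n / 8))) ∎)
  where lemma : ∀ q → 7 + q * 8 ≡ suc (2 * (3 + 4 * q))
        lemma = solve-∀

sumDiff : ℕ → ℕ → ℕ × ℕ
sumDiff a b = (a + b , ∣ a - b ∣)

sqNorm : ℕ × ℕ → ℕ
sqNorm (u , v) = u * u + v * v

data Gap : ℕ → ℕ → Set where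
  below : ∀ m t → Gap m (m + t)
  above : ∀ m t → Gap (m + t) m

gap : ∀ a b → Gap a b
gap a b with ≤-total a b
... | inj₁ a≤b with t , refl ← m≤n⇒∃[o]m+o≡n a≤b = below a t
... | inj₂ b≤a with t , refl ← m≤n⇒∃[o]m+o≡n b≤a = above b t

sortedForm : ∀ {a b} → Gap a b → ℕ × ℕ
sortedForm (below m t) = (m + (m + t) , t)
sortedForm (above m t) = (m + (m + t) , t)

sumDiff-below : ∀ m t → sumDiff m (m + t) ≡ (m + (m + t) , t)
sumDiff-below m t = cong (m + (m + t) ,_) (∣m-m+n∣≡n m t)

sumDiff-above : ∀ m t → sumDiff (m + t) m ≡ (m + (m + t) , t)
sumDiff-above m t = cong₂ _,_ (+-comm (m + t) m) (trans (∣-∣-comm (m + t) m) (∣m-m+n∣≡n m t))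

sumDiff-sorted : ∀ {a b} (g : Gap a b) → sumDiff a b ≡ sortedForm g
sumDiff-sorted (below m t) = sumDiff-below m t
sumDiff-sorted (above m t) = sumDiff-above m t

sorted-injective : ∀ {m m' t t'} → (m + (m + t) , t) ≡ (m' + (m' + t') , t') → m ≡ m' × t ≡ t'
sorted-injective {m} {m'} {t} eq with cong proj₂ eq
... | refl = *-cancelˡ-≡ m m' 2 (+-cancelʳ-≡ t (2 * m) (2 * m') (begin
  2 * m + t        ≡⟨ twice m t ⟩
  m + (m + t)      ≡⟨ cong proj₁ eq ⟩
  m' + (m' + t)    ≡⟨ sym (twice m' t) ⟩
  2 * m' + t       ∎)) , refl
  where twice : ∀ m t → 2 * m + t ≡ m + (m + t)
        twice = solve-∀

sumDiff-injective : ∀ {a b a' b'} → sumDiff a b ≡ sumDiff a' b' → (a ≡ a' × b ≡ b') ⊎ (a ≡ b' × b ≡ a')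
sumDiff-injective {a} {b} {a'} {b'} eq =
  unsort (gap a b) (gap a' b') (trans (sym (sumDiff-sorted (gap a b))) (trans eq (sumDiff-sorted (gap a' b'))))
  where
  unsort : ∀ {a b a' b'} (g : Gap a b) (g' : Gap a' b') → sortedForm g ≡ sortedForm g' →
           (a ≡ a' × b ≡ b') ⊎ (a ≡ b' × b ≡ a')
  unsort (below m t) (below m' t') eq with refl , refl ← sorted-injective {m} {m'} {t} {t'} eq = inj₁ (refl , refl)
  unsort (below m t) (above m' t') eq with refl , refl ← sorted-injective {m} {m'} {t} {t'} eq = inj₂ (refl , refl)
  unsort (above m t) (below m' t') eq with refl , refl ← sorted-injective {m} {m'} {t} {t'} eq = inj₂ (refl , refl)
  unsort (above m t) (above m' t') eq with refl , refl ← sorted-injective {m} {m'} {t} {t'} eq = inj₁ (refl , refl)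

sumDiff-sqNorm : ∀ a b → sqNorm (sumDiff a b) ≡ 2 * (a * a + b * b)
sumDiff-sqNorm a b = trans (cong sqNorm (sumDiff-sorted (gap a b))) (sorted-sqNorm (gap a b))
  where
  sorted-sqNorm : ∀ {a b} (g : Gap a b) → sqNorm (sortedForm g) ≡ 2 * (a * a + b * b)
  sorted-sqNorm (below m t) = lemma m t
    where lemma : ∀ m t → (m + (m + t)) * (m + (m + t)) + t * t ≡ 2 * (m * m + (m + t) * (m + t))
          lemma = solve-∀
  sorted-sqNorm (above m t) = lemma m t
    where lemma : ∀ m t → (m + (m + t)) * (m + (m + t)) + t * t ≡ 2 * ((m + t) * (m + t) + m * m)
          lemma = solve-∀

diff<sum : ∀ {a b} → 1 ≤ a → 1 ≤ b → proj₂ (sumDiff a b) < proj₁ (sumDiff a b)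
diff<sum {a} {b} 1≤a 1≤b =
  subst (λ P → proj₂ P < proj₁ P) (sym (sumDiff-sorted (gap a b))) (sorted< (gap a b) 1≤a 1≤b)
  where
  sorted< : ∀ {a b} (g : Gap a b) → 1 ≤ a → 1 ≤ b → proj₂ (sortedForm g) < proj₁ (sortedForm g)
  sorted< (below m t) 1≤m _ = +-mono-≤ 1≤m (m≤n+m t m)
  sorted< (above m t) _ 1≤m = +-mono-≤ 1≤m (m≤n+m t m)

diff-odd : ∀ {a b} → Odd (a + b) → Odd ∣ a - b ∣
diff-odd {a} {b} odd-sum =
  subst Odd (sym (cong proj₂ sorted)) (sorted-odd (gap a b) (subst Odd (cong proj₁ sorted) odd-sum))
  where
  sorted : sumDiff a b ≡ sortedForm (gap a b)
  sorted = sumDiff-sorted (gap a b)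
  gap-odd : ∀ m t → Odd (m + (m + t)) → Odd t
  gap-odd m t odd-sum with parityView t
  ... | odd k = k , refl
  ... | even k = ⊥-elim (even∧odd⇒⊥ (m + k , lemma m k) odd-sum)
    where lemma : ∀ m k → m + (m + 2 * k) ≡ 2 * (m + k)
          lemma = solve-∀
  sorted-odd : ∀ {a b} (g : Gap a b) → Odd (proj₁ (sortedForm g)) → Odd (proj₂ (sortedForm g))
  sorted-odd (below m t) = gap-odd m t
  sorted-odd (above m t) = gap-odd m t

orient : Fin 2 → ℕ × ℕ → ℕ × ℕ
orient zero P = P
orient (suc zero) P = swap P

oddPair : Fin 2 → ℕ → ℕ → ℕ × ℕ
oddPair o x z = orient o (sumDiff x (2 * z))

BothOdd : ℕ × ℕ → Set
BothOdd (u , v) = Odd u × Odd v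

orient-sqNorm : ∀ o P → sqNorm (orient o P) ≡ sqNorm P
orient-sqNorm zero P = refl
orient-sqNorm (suc zero) (u , v) = +-comm (v * v) (u * u)

orient-bothOdd : ∀ o {P} → BothOdd P → BothOdd (orient o P)
orient-bothOdd zero both = both
orient-bothOdd (suc zero) (odd-u , odd-v) = odd-v , odd-u

oddPair-sqNorm : ∀ o x z → sqNorm (oddPair o x z) ≡ 2 * (x * x + 2 * z * (2 * z))
oddPair-sqNorm o x z = trans (orient-sqNorm o (sumDiff x (2 * z))) (sumDiff-sqNorm x (2 * z))

oddPair-odd : ∀ o {x} z → Odd x → BothOdd (oddPair o x z)
oddPair-odd o {x} z odd-x = orient-bothOdd o (odd-sum , diff-odd {x} {2 * z} odd-sum)
  where odd-sum : Odd (x + 2 * z)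
        odd-sum = odd+even odd-x (z , refl)

sorted-decode : ∀ j d → ∃ λ x → ∃ λ z → sumDiff x (2 * z) ≡ (suc (2 * (j + d)) , suc (2 * j))
sorted-decode j d with parityView d
... | even e = 2 * e + suc (2 * j) , e , (begin
  sumDiff (2 * e + suc (2 * j)) (2 * e)            ≡⟨ sumDiff-above (2 * e) (suc (2 * j)) ⟩
  (2 * e + (2 * e + suc (2 * j)) , suc (2 * j))    ≡⟨ cong (_, suc (2 * j)) (lemma j e) ⟩
  (suc (2 * (j + 2 * e)) , suc (2 * j))            ∎)
  where lemma : ∀ j e → 2 * e + (2 * e + suc (2 * j)) ≡ suc (2 * (j + 2 * e))
        lemma = solve-∀
... | odd e = suc (2 * e) , suc (e + j) , (begin
  sumDiff (suc (2 * e)) (2 * suc (e + j))                   ≡⟨ cong (sumDiff (suc (2 * e))) (split e j) ⟩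
  sumDiff (suc (2 * e)) (suc (2 * e) + suc (2 * j))         ≡⟨ sumDiff-below (suc (2 * e)) (suc (2 * j)) ⟩
  (suc (2 * e) + (suc (2 * e) + suc (2 * j)) , suc (2 * j)) ≡⟨ cong (_, suc (2 * j)) (lemma j e) ⟩
  (suc (2 * (j + suc (2 * e))) , suc (2 * j))               ∎)
  where split : ∀ e j → 2 * suc (e + j) ≡ suc (2 * e) + suc (2 * j)
        split = solve-∀
        lemma : ∀ j e → suc (2 * e) + (suc (2 * e) + suc (2 * j)) ≡ suc (2 * (j + suc (2 * e)))
        lemma = solve-∀

oddPair-surjective : ∀ {u v} → Odd u → Odd v → ∃ λ o → ∃ λ x → ∃ λ z → oddPair o x z ≡ (u , v)
oddPair-surjective (i , refl) (j , refl) with gap i j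
... | above j d with x , z , eq ← sorted-decode j d = zero , x , z , eq
... | below i d with x , z , eq ← sorted-decode i d = suc zero , x , z , cong swap eq

odd≥1 : ∀ {x} → Odd x → 1 ≤ x
odd≥1 (_ , refl) = s≤s z≤n

-- equal unoriented pairs: {x , 2z} is recovered, and parity decides which entry is x
unoriented : ∀ {x x' z z'} → Odd x → Odd x' → sumDiff x (2 * z) ≡ sumDiff x' (2 * z') → x ≡ x' × z ≡ z'
unoriented {z = z} {z'} odd-x odd-x' eq with sumDiff-injective eq
... | inj₁ (x≡x' , 2z≡2z') = x≡x' , *-cancelˡ-≡ z z' 2 2z≡2z'
... | inj₂ (x≡2z' , _) = ⊥-elim (even∧odd⇒⊥ (z' , x≡2z') odd-x)

-- opposite orientations would put each difference above the other sum
crossed : ∀ {s d s' d'} → d < s → d' < s' → (s , d) ≡ (d' , s') → ⊥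
crossed d<s d'<s' refl = <-asym d<s d'<s'

diff<sum-oddPair : ∀ {x z} → Odd x → 1 ≤ z → ∣ x - 2 * z ∣ < x + 2 * z
diff<sum-oddPair {z = z} odd-x 1≤z = diff<sum (odd≥1 odd-x) (≤-trans 1≤z (m≤n*m z 2))

oddPair-injective : ∀ o o' {x x' z z'} → Odd x → Odd x' → 1 ≤ z → 1 ≤ z' →
                    oddPair o x z ≡ oddPair o' x' z' → o ≡ o' × x ≡ x' × z ≡ z'
oddPair-injective zero zero odd-x odd-x' _ _ eq = refl , unoriented odd-x odd-x' eq
oddPair-injective (suc zero) (suc zero) odd-x odd-x' _ _ eq = refl , unoriented odd-x odd-x' (cong swap eq)
oddPair-injective zero (suc zero) odd-x odd-x' 1≤z 1≤z' eq =
  ⊥-elim (crossed (diff<sum-oddPair odd-x 1≤z) (diff<sum-oddPair odd-x' 1≤z') eq)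
oddPair-injective (suc zero) zero odd-x odd-x' 1≤z 1≤z' eq =
  ⊥-elim (crossed (diff<sum-oddPair odd-x' 1≤z') (diff<sum-oddPair odd-x 1≤z) (sym eq))

place : Fin 3 → ℕ → ℕ × ℕ → Triple
place zero e (u , v) = (e , u , v)
place (suc zero) e (u , v) = (u , e , v)
place (suc (suc zero)) e (u , v) = (u , v , e)

place-value : ∀ p e P → value fR (place p e P) ≡ e * e + sqNorm P
place-value zero e (u , v) = +-assoc (e * e) (u * u) (v * v)
place-value (suc zero) e (u , v) = lemma (e * e) (u * u) (v * v)
  where lemma : ∀ a b c → b + a + c ≡ a + (b + c)
        lemma = solve-∀
place-value (suc (suc zero)) e (u , v) = +-comm (u * u + v * v) (e * e)

-- a² + b² + c² = 2n with n odd is ≡ 2 (mod 4), so exactly two of a, b, c are odd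
three-squares-mod4 : ∀ {a b c n} (va : ParityView a) (vb : ParityView b) (vc : ParityView c) → Odd n →
                     a * a + b * b + c * c ≡ 2 * n → (oddBit va + oddBit vb + oddBit vc) % 4 ≡ 2
three-squares-mod4 {a} {b} {c} va vb vc (m , refl) eq
  with qa , ea ← square-mod4 va | qb , eb ← square-mod4 vb | qc , ec ← square-mod4 vc = begin
  (ra + rb + rc) % 4                                ≡⟨ sym ([m+kn]%n≡m%n (ra + rb + rc) (qa + qb + qc) 4) ⟩
  (ra + rb + rc + (qa + qb + qc) * 4) % 4           ≡⟨ cong (_% 4) (regroup ra rb rc qa qb qc) ⟩
  ((ra + qa * 4) + (rb + qb * 4) + (rc + qc * 4)) % 4 ≡⟨ cong (_% 4) (sym (cong₂ _+_ (cong₂ _+_ ea eb) ec)) ⟩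
  (a * a + b * b + c * c) % 4                       ≡⟨ cong (_% 4) (trans eq (twice-odd m)) ⟩
  (2 + m * 4) % 4                                   ≡⟨ [m+kn]%n≡m%n 2 m 4 ⟩
  2                                                 ∎
  where
  ra rb rc : ℕ
  ra = oddBit va
  rb = oddBit vb
  rc = oddBit vc
  regroup : ∀ ra rb rc qa qb qc → ra + rb + rc + (qa + qb + qc) * 4 ≡ (ra + qa * 4) + (rb + qb * 4) + (rc + qc * 4)
  regroup = solve-∀
  twice-odd : ∀ m → 2 * suc (2 * m) ≡ 2 + m * 4
  twice-odd = solve-∀

EvenPlaced : Triple → Set
EvenPlaced t = ∃ λ p → ∃ λ y → ∃ λ P → t ≡ place p (2 * y) P × BothOdd P

one-even-entry : ∀ {n a b c} → Odd n → IsRoot fR (2 * n) (a , b , c) → EvenPlaced (a , b , c)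
one-even-entry {n} {a} {b} {c} odd-n root = shape va vb vc (three-squares-mod4 {n = n} va vb vc odd-n root)
  where
  va : ParityView a
  va = parityView a
  vb : ParityView b
  vb = parityView b
  vc : ParityView c
  vc = parityView c
  shape : ∀ {a b c} (va : ParityView a) (vb : ParityView b) (vc : ParityView c) →
          (oddBit va + oddBit vb + oddBit vc) % 4 ≡ 2 → EvenPlaced (a , b , c)
  shape (even k) (odd i) (odd j) _ = zero , k , _ , refl , (i , refl) , (j , refl)
  shape (odd i) (even k) (odd j) _ = suc zero , k , _ , refl , (i , refl) , (j , refl)
  shape (odd i) (odd j) (even k) _ = suc (suc zero) , k , _ , refl , (i , refl) , (j , refl)
  shape (even _) (even _) (even _) ()
  shape (even _) (even _) (odd _) ()
  shape (even _) (odd _) (even _) ()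
  shape (odd _) (even _) (even _) ()
  shape (odd _) (odd _) (odd _) ()

place-injective : ∀ p p' {e e' P P'} → Even e → Even e' → BothOdd P → BothOdd P' →
                  place p e P ≡ place p' e' P' → p ≡ p' × e ≡ e' × P ≡ P'
place-injective zero zero _ _ _ _ refl = refl , refl , refl
place-injective (suc zero) (suc zero) _ _ _ _ refl = refl , refl , refl
place-injective (suc (suc zero)) (suc (suc zero)) _ _ _ _ refl = refl , refl , refl
place-injective zero (suc zero) even-e _ _ (odd-u' , _) refl = ⊥-elim (even∧odd⇒⊥ even-e odd-u')
place-injective zero (suc (suc zero)) even-e _ _ (odd-u' , _) refl = ⊥-elim (even∧odd⇒⊥ even-e odd-u')
place-injective (suc zero) zero _ even-e' (odd-u , _) _ refl = ⊥-elim (even∧odd⇒⊥ even-e' odd-u)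
place-injective (suc zero) (suc (suc zero)) even-e _ _ (_ , odd-v') refl = ⊥-elim (even∧odd⇒⊥ even-e odd-v')
place-injective (suc (suc zero)) zero _ even-e' (odd-u , _) _ refl = ⊥-elim (even∧odd⇒⊥ even-e' odd-u)
place-injective (suc (suc zero)) (suc zero) _ even-e' (_ , odd-v) _ refl = ⊥-elim (even∧odd⇒⊥ even-e' odd-v)

x-odd : ∀ {n x y z} → Odd n → IsRoot fT n (x , y , z) → Odd x
x-odd {x = x} {y} {z} (m , refl) root with parityView x
... | odd i = i , refl
... | even k = ⊥-elim (even∧odd⇒⊥ (2 * (k * k) + y * y + 2 * (z * z) , lemma k y z) (m , root))
  where lemma : ∀ k y z → 2 * k * (2 * k) + 2 * (y * y) + 4 * (z * z) ≡ 2 * (2 * (k * k) + y * y + 2 * (z * z))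
        lemma = solve-∀

-- for n ≡ 7 (mod 8) the root z is positive: x² + 2y² ≡ 1 or 3 (mod 8) when x is odd
z-positive : ∀ {n x y z} → n % 8 ≡ 7 → Odd x → IsRoot fT n (x , y , z) → 1 ≤ z
z-positive {z = suc _} _ _ _ = s≤s z≤n
z-positive {n} {y = y} {z = zero} n%8≡7 (i , refl) root = ⊥-elim (impossible vy residue)
  where
  vy : ParityView y
  vy = parityView y
  residue : (1 + 2 * oddBit vy) % 8 ≡ 7
  residue with s , es ← odd-square-mod8 i | q , eq ← square-mod4 vy = begin
    (1 + 2 * oddBit vy) % 8                                 ≡⟨ sym ([m+kn]%n≡m%n (1 + 2 * oddBit vy) (s + q) 8) ⟩
    (1 + 2 * oddBit vy + (s + q) * 8) % 8                   ≡⟨ cong (_% 8) (regroup (oddBit vy) s q) ⟩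
    ((1 + s * 8) + 2 * (oddBit vy + q * 4) + 4 * (0 * 0)) % 8
      ≡⟨ cong (_% 8) (trans (sym (cong₂ (λ a b → fT a b 0) es eq)) root) ⟩
    n % 8                                                   ≡⟨ n%8≡7 ⟩
    7                                                       ∎
    where regroup : ∀ r s q → 1 + 2 * r + (s + q) * 8 ≡ (1 + s * 8) + 2 * (r + q * 4) + 4 * (0 * 0)
          regroup = solve-∀
  impossible : ∀ {y} (v : ParityView y) → (1 + 2 * oddBit v) % 8 ≡ 7 → ⊥
  impossible (even _) ()
  impossible (odd _) ()

-- a position for 2y, an orientation of the odd pair, and a root (x , y , z)
Tag : Set
Tag = Fin 3 × Fin 2 × Triple

φ : Tag → Triple
φ (p , o , (x , y , z)) = place p (2 * y) (oddPair o x z)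

φ-value : ∀ w → value fR (φ w) ≡ 2 * value fT (proj₂ (proj₂ w))
φ-value (p , o , (x , y , z)) = begin
  value fR (place p (2 * y) (oddPair o x z))           ≡⟨ place-value p (2 * y) (oddPair o x z) ⟩
  2 * y * (2 * y) + sqNorm (oddPair o x z)             ≡⟨ cong (2 * y * (2 * y) +_) (oddPair-sqNorm o x z) ⟩
  2 * y * (2 * y) + 2 * (x * x + 2 * z * (2 * z))      ≡⟨ lemma x y z ⟩
  2 * (x * x + 2 * (y * y) + 4 * (z * z))              ∎
  where lemma : ∀ x y z → 2 * y * (2 * y) + 2 * (x * x + 2 * z * (2 * z)) ≡ 2 * (x * x + 2 * (y * y) + 4 * (z * z))
        lemma = solve-∀

tagged : ℕ → List Tag
tagged n = cartesianProduct (allFin 3) (cartesianProduct (allFin 2) (roots fT n))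

length-tagged : ∀ n → length (tagged n) ≡ 6 * length (roots fT n)
length-tagged n = begin
  length (tagged n)                    ≡⟨ length-cartesianProduct (allFin 3) pairs ⟩
  length (allFin 3) * length pairs     ≡⟨ cong₂ _*_ (length-allFin 3) (length-cartesianProduct (allFin 2) rs) ⟩
  3 * (length (allFin 2) * length rs)  ≡⟨ cong (λ k → 3 * (k * length rs)) (length-allFin 2) ⟩
  3 * (2 * length rs)                  ≡⟨ sym (*-assoc 3 2 (length rs)) ⟩
  6 * length rs                        ∎
  where
  rs : List Triple
  rs = roots fT n
  pairs : List (Fin 2 × Triple)
  pairs = cartesianProduct (allFin 2) rs

∈-tagged⁺ : ∀ {n} p o {t} → IsRoot fT n t → (p , o , t) ∈ tagged n
∈-tagged⁺ p o root = ∈-cartesianProduct⁺ (∈-allFin p) (∈-cartesianProduct⁺ (∈-allFin o) (∈-roots fT-dominating root))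

∈-tagged⁻ : ∀ {n p o t} → (p , o , t) ∈ tagged n → IsRoot fT n t
∈-tagged⁻ {n} w∈ with _ , rest∈ ← ∈-cartesianProduct⁻ (allFin 3) _ w∈
                 with _ , t∈ ← ∈-cartesianProduct⁻ (allFin 2) (roots fT n) rest∈ =
  proj₂ (∈-filter⁻ (λ t → value fT t ≟ n) {xs = triples n} t∈)

φ-into : ∀ {n w} → w ∈ tagged n → φ w ∈ roots fR (2 * n)
φ-into {n} {p , o , t} w∈ = ∈-roots fR-dominating (trans (φ-value (p , o , t)) (cong (2 *_) (∈-tagged⁻ {n} w∈)))

φ-onto : ∀ {n} → Odd n → ∀ {t} → t ∈ roots fR (2 * n) → ∃ λ w → w ∈ tagged n × t ≡ φ w
φ-onto {n} odd-n {a , b , c} t∈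
  with root ← proj₂ (∈-filter⁻ (λ t → value fR t ≟ 2 * n) {xs = triples (2 * n)} t∈)
  with p , y , P , t≡ , (odd-u , odd-v) ← one-even-entry {n} odd-n root
  with o , x , z , pair≡ ← oddPair-surjective odd-u odd-v =
  (p , o , (x , y , z)) , ∈-tagged⁺ p o T-root , t≡φ
  where
  t≡φ : (a , b , c) ≡ φ (p , o , (x , y , z))
  t≡φ = trans t≡ (cong (place p (2 * y)) (sym pair≡))
  T-root : IsRoot fT n (x , y , z)
  T-root = *-cancelˡ-≡ _ _ 2 (begin
    2 * value fT (x , y , z)         ≡⟨ sym (φ-value (p , o , (x , y , z))) ⟩
    value fR (φ (p , o , (x , y , z))) ≡⟨ cong (value fR) (sym t≡φ) ⟩
    value fR (a , b , c)             ≡⟨ root ⟩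
    2 * n                            ∎)

tagged-odd-positive : ∀ {n p o x y z} → n % 8 ≡ 7 → (p , o , (x , y , z)) ∈ tagged n → Odd x × 1 ≤ z
tagged-odd-positive {n} {p} {o} {x} {y} {z} n%8≡7 w∈ = odd-x , z-positive {n} {x} {y} {z} n%8≡7 odd-x root
  where root : IsRoot fT n (x , y , z)
        root = ∈-tagged⁻ {n} {p} {o} w∈
        odd-x : Odd x
        odd-x = x-odd {n} {x} {y} {z} (odd-if-7-mod-8 n%8≡7) root

φ-injective : ∀ {n} → n % 8 ≡ 7 → InjectiveOn φ (tagged n)
φ-injective {n} n%8≡7 {p , o , (x , y , z)} {p' , o' , (x' , y' , z')} w∈ w'∈ eq
  with odd-x , 1≤z ← tagged-odd-positive {n} n%8≡7 w∈ | odd-x' , 1≤z' ← tagged-odd-positive {n} n%8≡7 w'∈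
  with refl , 2y≡2y' , pair≡ ← place-injective p p' (y , refl) (y' , refl)
                                  (oddPair-odd o z odd-x) (oddPair-odd o' z' odd-x') eq
  with refl , refl , refl ← oddPair-injective o o' odd-x odd-x' 1≤z 1≤z' pair≡
  with refl ← *-cancelˡ-≡ y y' 2 2y≡2y' = refl

roots-correspondence : ∀ {n} → n % 8 ≡ 7 → length (roots fR (2 * n)) ≡ length (tagged n)
roots-correspondence {n} n%8≡7 =
  length-by-image φ
    (unique-roots fR (2 * n))
    (cartesianProduct⁺ (allFin⁺ 3) (cartesianProduct⁺ (allFin⁺ 2) (unique-roots fT n)))
    (φ-injective {n} n%8≡7) (φ-into {n}) (φ-onto {n} (odd-if-7-mod-8 n%8≡7))

lemma3p7 : (n : ℕ) → 0 < n → n % 8 ≡ 7 → R3 (2 * n) ≡ 6 * T n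
lemma3p7 n _ n%8≡7 = begin
  R3 (2 * n)                 ≡⟨ count≡roots {m = 2 * n} fR-dominating ⟩
  length (roots fR (2 * n))  ≡⟨ roots-correspondence {n} n%8≡7 ⟩
  length (tagged n)          ≡⟨ length-tagged n ⟩
  6 * length (roots fT n)    ≡⟨ cong (6 *_) (sym (count≡roots {m = n} fT-dominating)) ⟩
  6 * T n                    ∎
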